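{- The notion of reduction $\mathit{ass}$ is Church–Rosser: for all computations $M,N,L$, if $M\longrightarrow^*_{\mathit{ass}}N$ and $M\longrightarrow^*_{\mathit{ass}}L$, then there is a computation $M'$ with $N\longrightarrow^*_{\mathit{ass}}M'$ and $L\longrightarrow^*_{\mathit{ass}}M'$.
   Context: Syntax of $\lambda_c^u$: values $V ::= x\mid \lambda x.M$, computations $M ::= \mathit{unit}\,V\mid M\star V$ (up to renaming of bound variables). $\mathit{ass}$ is the set of pairs $((L\star\lambda x.M)\star\lambda y.N,\ L\star\lambda x.(M\star\lambda y.N))$ with $x\notin FV(N)$. $\longrightarrow_{\mathit{ass}}$ is its compatible closure: if $(M,M')\in\mathit{ass}$ then $\mathcal C[M]\longrightarrow_{\mathit{ass}}\mathcal C[M']$ for every computation context, where value contexts are $\mathcal V ::= [\cdot]\mid\lambda x.\mathcal C$ and computation contexts $\mathcal C ::= [\cdot]\mid\mathit{unit}\,\mathcal V\mid\mathcal C\star V\mid M\star\mathcal V$. $\longrightarrow^*_{\mathit{ass}}$ is its reflexive–transitive closure. -}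

module Defs where

open import Data.Nat using (ℕ; zero; suc)
open import Data.Fin using (Fin; zero; suc)
open import Relation.Binary.Construct.Closure.ReflexiveTransitive using (Star)

-- Syntax of λ_c^u, with bound variables as de Bruijn indices (so terms are
-- identified up to renaming of bound variables).
mutual
  data Val (n : ℕ) : Set where
    var : Fin n → Val n
    lam : Comp (suc n) → Val n

  data Comp (n : ℕ) : Set where
    unit : Val n → Comp n
    _⋆_  : Comp n → Val n → Comp n

infixl 5 _⋆_

Ren : ℕ → ℕ → Set
Ren n m = Fin n → Fin m

ext : ∀ {n m} → Ren n m → Ren (suc n) (suc m)
ext ρ zero    = zero
ext ρ (suc i) = suc (ρ i)

mutual
  renV : ∀ {n m} → Ren n m → Val n → Val m
  renV ρ (var i) = var (ρ i)
  renV ρ (lam M) = lam (renC (ext ρ) M)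

  renC : ∀ {n m} → Ren n m → Comp n → Comp m
  renC ρ (unit V) = unit (renV ρ V)
  renC ρ (M ⋆ V)  = renC ρ M ⋆ renV ρ V

wk : ∀ {n} → Val n → Val (suc n)
wk = renV suc

-- The notion of reduction ass:
--   (L ⋆ λx.M) ⋆ λy.N  ass  L ⋆ λx.(M ⋆ λy.N)   with x ∉ FV(N).
-- With de Bruijn indices the side condition is expressed by the fact that on
-- the right, λy.N is the weakening of a value not mentioning x.
data Ass {n : ℕ} : Comp n → Comp n → Set where
  ass : (L : Comp n) (M : Comp (suc n)) (N : Comp (suc n)) →
        Ass ((L ⋆ lam M) ⋆ lam N) (L ⋆ lam (M ⋆ wk (lam N)))

mutual
  data _⟶V_ {n : ℕ} : Val n → Val n → Set where
    ξ-lam : ∀ {M M'} → M ⟶C M' → lam M ⟶V lam M'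

  data _⟶C_ {n : ℕ} : Comp n → Comp n → Set where
    base  : ∀ {M M'} → Ass M M' → M ⟶C M'
    ξ-unit : ∀ {V V'} → V ⟶V V' → unit V ⟶C unit V'
    ξ-⋆ₗ  : ∀ {M M' V} → M ⟶C M' → (M ⋆ V) ⟶C (M' ⋆ V)
    ξ-⋆ᵣ  : ∀ {M V V'} → V ⟶V V' → (M ⋆ V) ⟶C (M ⋆ V')

infix 4 _⟶C_ _⟶V_ _⟶*_

_⟶*_ : ∀ {n} → Comp n → Comp n → Set
_⟶*_ = Star _⟶C_

-- ass only re-brackets ⋆-chains to the right, so it has a computable normal
-- form: nf rewrites (L ⋆ λx.M) ⋆ λy.N to L ⋆ λx.(M ⋆ λy.N) recursively inside
-- the body.  One ass-step leaves nf unchanged (the rotation is associative up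
-- to weakening), and every term reduces to its nf, so any two reducts of M
-- meet in nf M.
module Submission where

open import Defs
open import Data.Nat using (ℕ)
open import Data.Fin using (zero; suc)
open import Data.Product using (∃; _×_; _,_)
open import Function using (_∘_)
open import Relation.Binary.Core using (Rel)
open import Relation.Binary.PropositionalEquality
open import Relation.Binary.Construct.Closure.ReflexiveTransitive
  using (Star; ε; _◅_; _◅◅_; gmap)

confluent-by-normaliser : ∀ {a ℓ} {A : Set a} {_⟶_ : Rel A ℓ} (nf : A → A) →
  (∀ {x y} → x ⟶ y → nf x ≡ nf y) → (∀ x → Star _⟶_ x (nf x)) →
  ∀ {x y z} → Star _⟶_ x y → Star _⟶_ x z → ∃ λ w → Star _⟶_ y w × Star _⟶_ z w
confluent-by-normaliser {_⟶_ = _⟶_} nf nf-step to-nf {x} {y} {z} x⟶*y x⟶*z =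
  nf x , subst (Star _⟶_ y) (sym (nf-steps x⟶*y)) (to-nf y)
       , subst (Star _⟶_ z) (sym (nf-steps x⟶*z)) (to-nf z)
  where
  nf-steps : ∀ {u v} → Star _⟶_ u v → nf u ≡ nf v
  nf-steps ε        = refl
  nf-steps (s ◅ ss) = trans (nf-step s) (nf-steps ss)

ext-cong : ∀ {n m} {ρ σ : Ren n m} → (∀ i → ρ i ≡ σ i) → ∀ i → ext ρ i ≡ ext σ i
ext-cong e zero    = refl
ext-cong e (suc i) = cong suc (e i)

mutual
  renV-cong : ∀ {n m} {ρ σ : Ren n m} → (∀ i → ρ i ≡ σ i) → ∀ V → renV ρ V ≡ renV σ V
  renV-cong e (var i) = cong var (e i)
  renV-cong e (lam M) = cong lam (renC-cong (ext-cong e) M)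

  renC-cong : ∀ {n m} {ρ σ : Ren n m} → (∀ i → ρ i ≡ σ i) → ∀ M → renC ρ M ≡ renC σ M
  renC-cong e (unit V) = cong unit (renV-cong e V)
  renC-cong e (M ⋆ V)  = cong₂ _⋆_ (renC-cong e M) (renV-cong e V)

ext-∘ : ∀ {n m k} (ρ : Ren m k) (σ : Ren n m) i → ext ρ (ext σ i) ≡ ext (ρ ∘ σ) i
ext-∘ ρ σ zero    = refl
ext-∘ ρ σ (suc i) = refl

mutual
  renV-∘ : ∀ {n m k} (ρ : Ren m k) (σ : Ren n m) V → renV ρ (renV σ V) ≡ renV (ρ ∘ σ) V
  renV-∘ ρ σ (var i) = refl
  renV-∘ ρ σ (lam M) = cong lam (trans (renC-∘ (ext ρ) (ext σ) M) (renC-cong (ext-∘ ρ σ) M))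

  renC-∘ : ∀ {n m k} (ρ : Ren m k) (σ : Ren n m) M → renC ρ (renC σ M) ≡ renC (ρ ∘ σ) M
  renC-∘ ρ σ (unit V) = cong unit (renV-∘ ρ σ V)
  renC-∘ ρ σ (M ⋆ V)  = cong₂ _⋆_ (renC-∘ ρ σ M) (renV-∘ ρ σ V)

renV-ext-wk : ∀ {n m} (ρ : Ren n m) V → renV (ext ρ) (wk V) ≡ wk (renV ρ V)
renV-ext-wk ρ V = trans (renV-∘ (ext ρ) suc V) (sym (renV-∘ suc ρ V))

-- For M and V in normal form, M ⋆ₙ V is the normal form of M ⋆ V.
_⋆ₙ_ : ∀ {n} → Comp n → Val n → Comp n
unit U      ⋆ₙ W       = unit U ⋆ W
(L ⋆ var i) ⋆ₙ W       = (L ⋆ var i) ⋆ W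
(L ⋆ lam M) ⋆ₙ var j   = (L ⋆ lam M) ⋆ var j
(L ⋆ lam M) ⋆ₙ lam N   = L ⋆ lam (M ⋆ₙ wk (lam N))

infixl 5 _⋆ₙ_

mutual
  nfV : ∀ {n} → Val n → Val n
  nfV (var i) = var i
  nfV (lam M) = lam (nf M)

  nf : ∀ {n} → Comp n → Comp n
  nf (unit V) = unit (nfV V)
  nf (M ⋆ V)  = nf M ⋆ₙ nfV V

mutual
  renC-⋆ₙ : ∀ {n m} (ρ : Ren n m) M V → renC ρ (M ⋆ₙ V) ≡ renC ρ M ⋆ₙ renV ρ V
  renC-⋆ₙ ρ (unit U)    W       = refl
  renC-⋆ₙ ρ (L ⋆ var i) W       = refl
  renC-⋆ₙ ρ (L ⋆ lam M) (var j) = refl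
  renC-⋆ₙ ρ (L ⋆ lam M) (lam N) = cong (λ X → renC ρ L ⋆ lam X) (renC-ext-⋆ₙ-wk ρ M (lam N))

  renC-ext-⋆ₙ-wk : ∀ {n m} (ρ : Ren n m) M V →
    renC (ext ρ) (M ⋆ₙ wk V) ≡ renC (ext ρ) M ⋆ₙ wk (renV ρ V)
  renC-ext-⋆ₙ-wk ρ M V =
    trans (renC-⋆ₙ (ext ρ) M (wk V)) (cong (renC (ext ρ) M ⋆ₙ_) (renV-ext-wk ρ V))

mutual
  nfV-renV : ∀ {n m} (ρ : Ren n m) V → nfV (renV ρ V) ≡ renV ρ (nfV V)
  nfV-renV ρ (var i) = refl
  nfV-renV ρ (lam M) = cong lam (nf-renC (ext ρ) M)

  nf-renC : ∀ {n m} (ρ : Ren n m) M → nf (renC ρ M) ≡ renC ρ (nf M)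
  nf-renC ρ (unit V) = cong unit (nfV-renV ρ V)
  nf-renC ρ (M ⋆ V)  =
    trans (cong₂ _⋆ₙ_ (nf-renC ρ M) (nfV-renV ρ V)) (sym (renC-⋆ₙ ρ (nf M) (nfV V)))

⋆ₙ-assoc : ∀ {n} (L : Comp n) A B → L ⋆ₙ lam A ⋆ₙ lam B ≡ L ⋆ₙ lam (A ⋆ₙ wk (lam B))
⋆ₙ-assoc (unit U)    A B = refl
⋆ₙ-assoc (L ⋆ var i) A B = refl
⋆ₙ-assoc (L ⋆ lam C) A B = cong (λ X → L ⋆ lam X) (begin
  C ⋆ₙ wk (lam A) ⋆ₙ wk (lam B)                          ≡⟨ ⋆ₙ-assoc C (renC (ext suc) A) (renC (ext suc) B) ⟩
  C ⋆ₙ lam (renC (ext suc) A ⋆ₙ wk (wk (lam B)))         ≡˘⟨ cong (λ X → C ⋆ₙ lam X) (renC-ext-⋆ₙ-wk suc A (lam B)) ⟩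
  C ⋆ₙ wk (lam (A ⋆ₙ wk (lam B)))                        ∎)
  where open ≡-Reasoning

mutual
  nfV-⟶V : ∀ {n} {V V' : Val n} → V ⟶V V' → nfV V ≡ nfV V'
  nfV-⟶V (ξ-lam s) = cong lam (nf-⟶C s)

  nf-⟶C : ∀ {n} {M M' : Comp n} → M ⟶C M' → nf M ≡ nf M'
  nf-⟶C (base (ass L M N)) = begin
    nf L ⋆ₙ lam (nf M) ⋆ₙ lam (nf N)               ≡⟨ ⋆ₙ-assoc (nf L) (nf M) (nf N) ⟩
    nf L ⋆ₙ lam (nf M ⋆ₙ wk (lam (nf N)))          ≡˘⟨ cong (λ X → nf L ⋆ₙ lam (nf M ⋆ₙ X)) (nfV-renV suc (lam N)) ⟩
    nf L ⋆ₙ lam (nf M ⋆ₙ nfV (wk (lam N)))         ∎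
    where open ≡-Reasoning
  nf-⟶C (ξ-unit s)            = cong unit (nfV-⟶V s)
  nf-⟶C {M = M ⋆ V} (ξ-⋆ₗ s) = cong (_⋆ₙ nfV V) (nf-⟶C s)
  nf-⟶C {M = M ⋆ V} (ξ-⋆ᵣ s) = cong (nf M ⋆ₙ_) (nfV-⟶V s)

⋆⟶*⋆ₙ : ∀ {n} (M : Comp n) V → M ⋆ V ⟶* M ⋆ₙ V
⋆⟶*⋆ₙ (unit U)    W       = ε
⋆⟶*⋆ₙ (L ⋆ var i) W       = ε
⋆⟶*⋆ₙ (L ⋆ lam M) (var j) = ε
⋆⟶*⋆ₙ (L ⋆ lam M) (lam N) =
  base (ass L M N) ◅ gmap (λ X → L ⋆ lam X) (ξ-⋆ᵣ ∘ ξ-lam) (⋆⟶*⋆ₙ M (wk (lam N)))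

mutual
  ⟶V*nfV : ∀ {n} (V : Val n) → Star _⟶V_ V (nfV V)
  ⟶V*nfV (var i) = ε
  ⟶V*nfV (lam M) = gmap lam ξ-lam (⟶*nf M)

  ⟶*nf : ∀ {n} (M : Comp n) → M ⟶* nf M
  ⟶*nf (unit V) = gmap unit ξ-unit (⟶V*nfV V)
  ⟶*nf (M ⋆ V)  =
    gmap (_⋆ V) ξ-⋆ₗ (⟶*nf M) ◅◅ gmap (nf M ⋆_) ξ-⋆ᵣ (⟶V*nfV V) ◅◅ ⋆⟶*⋆ₙ (nf M) (nfV V)

mainTheorem17 : ∀ {n : ℕ} (M N L : Comp n) → M ⟶* N → M ⟶* L →
    ∃ λ M' → (N ⟶* M') × (L ⟶* M')
mainTheorem17 _ _ _ = confluent-by-normaliser nf nf-⟶C ⟶*nf
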